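{- Let $x\in{}^\omega(\omega\setminus\{0\})$ be strictly increasing, let $T$ be an $x$-squeezed tree and let $n\in\omega$. Then $T\cap{}^n\omega$ is finite.
   Context: Trees are subsets of ${}^{<\omega}\omega$ closed under initial segments. For $x$ strictly increasing and $n\in\omega$, $(j,k,m)$ is an $x$-bound system above $n$ iff $k\in\omega$, $j,m$ are functions from $\{0,\dots,k\}$ into $\omega$, $j(0)>x(n+m(0)+1)$, and for all $l<k$, $j(l+1)>x(j(l)+m(l+1)+1)$. A tree $T$ is $(j,k,m,\eta)$-squeezed iff $T$ has no terminal nodes, $\mathrm{dom}(\eta)=\{(l,t): l\le k,\ t\le m(l)\}$, $\eta(l,t)\in{}^{j(l)}\omega$, and every $\nu\in T$ is comparable (one is an initial segment of the other) with some $\eta(l,t)$. $T$ is $x$-squeezed iff for every $n$ there is an $x$-bound system $(j,k,m)$ above $n$ and $\eta$ with $T$ $(j,k,m,\eta)$-squeezed. -}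

module Defs where

open import Data.Nat using (ℕ; zero; suc; _+_; _<_; _>_; _≤_)
open import Data.List using (List; _++_; [_]; length)
open import Data.List.Membership.Propositional using (_∈_)
open import Data.Fin using (Fin; inject₁; toℕ) renaming (zero to fzero; suc to fsuc)
open import Data.Product using (Σ; ∃; _×_; _,_)
open import Data.Sum using (_⊎_)
open import Relation.Binary.PropositionalEquality using (_≡_)

-- Finite sequences of naturals (elements of ^{<ω}ω) are lists.
Seq : Set
Seq = List ℕ

_⊑_ : Seq → Seq → Set
ν ⊑ μ = ∃ λ r → ν ++ r ≡ μ

Comparable : Seq → Seq → Set
Comparable ν μ = ν ⊑ μ ⊎ μ ⊑ ν

SeqSet : Set₁
SeqSet = Seq → Set

IsTree : SeqSet → Set
IsTree T = ∀ ν μ → T μ → ν ⊑ μ → T ν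

StrictlyIncreasing : (ℕ → ℕ) → Set
StrictlyIncreasing x = ∀ a b → a < b → x a < x b

NoTerminalNodes : SeqSet → Set
NoTerminalNodes T = ∀ ν → T ν → ∃ λ i → T (ν ++ [ i ])

IsBoundSystem : (x : ℕ → ℕ) (n k : ℕ) (j m : Fin (suc k) → ℕ) → Set
IsBoundSystem x n k j m =
  (j fzero > x (n + m fzero + 1)) ×
  (∀ (l : Fin k) → j (fsuc l) > x (j (inject₁ l) + m (fsuc l) + 1))

-- η has domain {(l,t) : l ≤ k, t ≤ m(l)} and η(l,t) ∈ ^{j(l)}ω
Eta : (k : ℕ) (j m : Fin (suc k) → ℕ) → Set
Eta k j m = (l : Fin (suc k)) → Fin (suc (m l)) → Seq

IsEta : (k : ℕ) (j m : Fin (suc k) → ℕ) → Eta k j m → Set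
IsEta k j m η = ∀ l t → length (η l t) ≡ j l

Squeezed : (T : SeqSet) (k : ℕ) (j m : Fin (suc k) → ℕ) (η : Eta k j m) → Set
Squeezed T k j m η =
  NoTerminalNodes T × IsEta k j m η ×
  (∀ ν → T ν → Σ (Fin (suc k)) λ l → Σ (Fin (suc (m l))) λ t → Comparable ν (η l t))

XSqueezed : (x : ℕ → ℕ) → SeqSet → Set
XSqueezed x T = ∀ (n : ℕ) →
  Σ ℕ λ k → Σ (Fin (suc k) → ℕ) λ j → Σ (Fin (suc k) → ℕ) λ m →
  Σ (Eta k j m) λ η → IsBoundSystem x n k j m × Squeezed T k j m η

FiniteSeqSet : SeqSet → Set
FiniteSeqSet S = ∃ λ (L : List Seq) → ∀ ν → S ν → ν ∈ L

-- Each j(l) of a bound system above n exceeds n, since j(0) > x(n + …) ≥ n and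
-- j(l+1) > x(j(l) + …) ≥ j(l).  A node ν of length n is comparable with some η(l,t),
-- which has length j(l) ≥ n, so ν is the length-n prefix of η(l,t).  Hence the
-- n-th level of T lies among the finitely many sequences take n (η(l,t)).
module Submission where

open import Defs
open import Data.Nat using (ℕ; zero; suc; _+_; _≤_; _<_; s≤s; z≤n)
open import Data.Nat.Properties using (≤-refl; ≤-trans; <⇒≤; <-trans; ≤-<-trans; <-≤-trans; m≤m+n; m<m+n; <⇒≱)
open import Data.List using (List; []; _∷_; _++_; length; take; map; concatMap; allFin)
open import Data.List.Properties using (length-++; take-all; ++-identityʳ)
open import Data.List.Membership.Propositional using (_∈_)
open import Data.List.Membership.Propositional.Properties using (∈-map⁺; ∈-concat⁺′; ∈-allFin)
open import Data.Fin using (Fin; inject₁) renaming (zero to fzero; suc to fsuc)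
open import Data.Product using (_×_; _,_)
open import Data.Sum using (inj₁; inj₂)
open import Data.Empty using (⊥-elim)
open import Relation.Binary.PropositionalEquality using (_≡_; refl; sym; cong; subst)

strictlyIncreasing⇒inflationary : ∀ {x} → StrictlyIncreasing x → ∀ i → i ≤ x i
strictlyIncreasing⇒inflationary inc zero    = z≤n
strictlyIncreasing⇒inflationary inc (suc i) =
  ≤-<-trans (strictlyIncreasing⇒inflationary inc i) (inc i (suc i) ≤-refl)

<-x[+1] : ∀ {x} → StrictlyIncreasing x → ∀ a b → a < x (a + b + 1)
<-x[+1] inc a b =
  <-≤-trans (≤-<-trans (m≤m+n a b) (m<m+n (a + b) (s≤s z≤n)))
            (strictlyIncreasing⇒inflationary inc (a + b + 1))

chain-lowerBound : ∀ {k a} (f : Fin (suc k) → ℕ) → a ≤ f fzero →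
                   (∀ l → f (inject₁ l) ≤ f (fsuc l)) → ∀ l → a ≤ f l
chain-lowerBound {zero}  f a≤f₀ step fzero    = a≤f₀
chain-lowerBound {suc k} f a≤f₀ step fzero    = a≤f₀
chain-lowerBound {suc k} f a≤f₀ step (fsuc l) =
  chain-lowerBound (λ i → f (fsuc i)) (≤-trans a≤f₀ (step fzero)) (λ i → step (fsuc i)) l

boundSystem⇒n<j : ∀ {x n k j m} → StrictlyIncreasing x →
                  IsBoundSystem x n k j m → ∀ l → n < j l
boundSystem⇒n<j {n = n} {j = j} {m} inc (j₀-bound , j-step) =
  chain-lowerBound j (<-trans (<-x[+1] inc n (m fzero)) j₀-bound)
    (λ l → <⇒≤ (<-trans (<-x[+1] inc (j (inject₁ l)) (m (fsuc l))) (j-step l)))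

take-length-++ : ∀ {A : Set} (xs ys : List A) → take (length xs) (xs ++ ys) ≡ xs
take-length-++ []       ys = refl
take-length-++ (x ∷ xs) ys = cong (x ∷_) (take-length-++ xs ys)

comparable⇒≡take : ∀ {ν η} → length ν ≤ length η → Comparable ν η → ν ≡ take (length ν) η
comparable⇒≡take {ν} _ (inj₁ (r , refl)) = sym (take-length-++ ν r)
comparable⇒≡take {η = η} _ (inj₂ ([] , refl))
  rewrite ++-identityʳ η = sym (take-all (length η) η ≤-refl)
comparable⇒≡take {η = η} |ν|≤|η| (inj₂ (a ∷ r , refl)) =
  ⊥-elim (<⇒≱ (m<m+n (length η) (s≤s z≤n))
              (subst (_≤ length η) (length-++ η) |ν|≤|η|))

tabulate₂ : ∀ {A : Set} {k} (m : Fin k → ℕ) → ((l : Fin k) → Fin (m l) → A) → List A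
tabulate₂ {k = k} m f = concatMap (λ l → map (f l) (allFin (m l))) (allFin k)

∈-tabulate₂ : ∀ {A : Set} {k} (m : Fin k → ℕ) (f : (l : Fin k) → Fin (m l) → A) l t →
              f l t ∈ tabulate₂ m f
∈-tabulate₂ m f l t =
  ∈-concat⁺′ (∈-map⁺ (f l) (∈-allFin t)) (∈-map⁺ (λ i → map (f i) (allFin (m i))) (∈-allFin l))

squeezed⇒finiteLevel : ∀ {T k j m} {η : Eta k j m} {n} → Squeezed T k j m η → (∀ l → n ≤ j l) →
                       FiniteSeqSet (λ ν → T ν × length ν ≡ n)
squeezed⇒finiteLevel {T} {k} {j} {m} {η} {n} (_ , η-lengths , covered) n≤j =
  map (take n) ηs , level⊆
  where
  ηs : List Seq
  ηs = tabulate₂ (λ l → suc (m l)) η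

  level⊆ : ∀ ν → T ν × length ν ≡ n → ν ∈ map (take n) ηs
  level⊆ ν (Tν , refl) with covered ν Tν
  ... | l , t , ν~η =
    subst (_∈ map (take n) ηs)
      (sym (comparable⇒≡take (subst (n ≤_) (sym (η-lengths l t)) (n≤j l)) ν~η))
      (∈-map⁺ (take n) (∈-tabulate₂ (λ l → suc (m l)) η l t))

lemma7p7 : (x : ℕ → ℕ) → (∀ i → 1 ≤ x i) → StrictlyIncreasing x →
    (T : SeqSet) → IsTree T → XSqueezed x T → (n : ℕ) →
    FiniteSeqSet (λ ν → T ν × length ν ≡ n)
lemma7p7 x _ inc T _ squeezed n with squeezed n
... | k , j , m , η , bound , T-squeezed =
  squeezed⇒finiteLevel {j = j} T-squeezed
    (λ l → <⇒≤ (boundSystem⇒n<j {x} {n} {j = j} {m} inc bound l))
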